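{- Let $G=(V,E)$ be a connected word-representable graph and let $w$ be a word representing $G$. Suppose $w = uXXv$, where $u,v$ are (possibly empty) words and $XX$ is a non-trivial square (i.e. $X$ is a word of length at least $2$). Then every vertex $x\in V$ occurs in $X$.
   Context: A word $w$ over the alphabet $V$ represents the simple graph $G=(V,E)$ if every letter of $V$ occurs in $w$ and, for all distinct $x,y\in V$, the letters $x$ and $y$ alternate in $w$ (i.e. deleting all other letters from $w$ leaves a word of the form $xyxy\cdots$ or $yxyx\cdots$, of odd or even length) if and only if $xy\in E$. $G$ is word-representable if some word represents it. A square in a word is a factor of the form $XX$ with $X$ a non-empty word; it is trivial if $X$ is a single letter, and non-trivial otherwise. -}

module Defs where

open import Data.Nat using (ℕ; suc; _≥_)
open import Data.Fin using (Fin)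
open import Data.Fin.Properties using (_≟_)
open import Data.List using (List; []; _∷_; _++_; filter; length)
open import Data.List.Membership.Propositional using (_∈_)
open import Data.Sum using (_⊎_)
open import Data.Product using (Σ; ∃; _×_)
open import Data.Empty using (⊥)
open import Data.Unit using (⊤)
open import Relation.Nullary using (¬_)
open import Relation.Nullary.Decidable using (_⊎-dec_)
open import Relation.Binary.PropositionalEquality using (_≡_)
open import Function.Bundles using (_⇔_)

record Graph (n : ℕ) : Set₁ where
  field
    Adj   : Fin n → Fin n → Set
    sym   : ∀ {x y} → Adj x y → Adj y x
    irrefl : ∀ {x} → ¬ Adj x x

open Graph public

Word : ℕ → Set
Word n = List (Fin n)

NoRepeat : ∀ {n} → Word n → Set
NoRepeat []           = ⊤
NoRepeat (a ∷ [])     = ⊤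
NoRepeat (a ∷ b ∷ w)  = ¬ (a ≡ b) × NoRepeat (b ∷ w)

restrict : ∀ {n} → Fin n → Fin n → Word n → Word n
restrict x y w = filter (λ z → (z ≟ x) ⊎-dec (z ≟ y)) w

-- x and y alternate in w: the restriction is of the form xyxy... or yxyx...
Alternate : ∀ {n} → Fin n → Fin n → Word n → Set
Alternate x y w = NoRepeat (restrict x y w)

Represents : ∀ {n} → Word n → Graph n → Set
Represents {n} w G =
  (∀ (x : Fin n) → x ∈ w) ×
  (∀ (x y : Fin n) → ¬ (x ≡ y) → (Alternate x y w ⇔ Adj G x y))

data Walk {n} (G : Graph n) : Fin n → Fin n → Set where
  here : ∀ {x} → Walk G x x
  step : ∀ {x y z} → Adj G x y → Walk G y z → Walk G x z

Connected : ∀ {n} → Graph n → Set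
Connected {n} G = ∀ (x y : Fin n) → Walk G x y

WordRepresentable : ∀ {n} → Graph n → Set
WordRepresentable {n} G = Σ (Word n) (λ w → Represents w G)

-- If some vertex x is missing from X, follow a walk from x to a letter of X; it
-- crosses an edge cd with c ∉ X and d ∈ X. Deleting all letters but c and d
-- turns the square XX into FF with F a non-empty power of d, so d occurs twice
-- in a row and c, d do not alternate in w, although they are adjacent.
module Submission where

open import Defs
open import Data.Nat using (ℕ; _≥_)
open import Data.Fin using (Fin)
open import Data.Fin.Properties using (_≟_)
open import Data.List using ([]; _∷_; _++_; length)
open import Data.List.Membership.Propositional using (_∈_; _∉_)
open import Data.List.Membership.Propositional.Properties using (∈-filter⁺; ∈-filter⁻)
import Data.List.Membership.DecPropositional as DecMembership
open import Data.List.Properties using (filter-++; ++-assoc)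
open import Data.List.Relation.Unary.All using (All; _∷_; tabulate)
open import Data.List.Relation.Unary.Any using (here)
open import Data.Product using (∃₂; _×_; _,_; proj₁; proj₂)
open import Data.Sum using (_⊎_; inj₁; inj₂)
open import Data.Unit using (tt)
open import Relation.Nullary using (¬_; yes; no; contradiction)
open import Relation.Nullary.Decidable using (_⊎-dec_; decidable-stable)
open import Relation.Unary using (Pred; Decidable)
open import Relation.Binary.PropositionalEquality using (_≡_; refl; trans; subst; cong)
import Relation.Binary.PropositionalEquality as ≡
open import Function.Bundles using (Equivalence)

module _ {n : ℕ} where

  NoRepeat-tail : ∀ (a : Fin n) (A : Word n) → NoRepeat (a ∷ A) → NoRepeat A
  NoRepeat-tail a []      _ = tt
  NoRepeat-tail a (b ∷ A) p = proj₂ p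

  NoRepeat-++⁻ʳ : ∀ (A B : Word n) → NoRepeat (A ++ B) → NoRepeat B
  NoRepeat-++⁻ʳ []      B p = p
  NoRepeat-++⁻ʳ (a ∷ A) B p = NoRepeat-++⁻ʳ A B (NoRepeat-tail a (A ++ B) p)

  ¬NoRepeat-constant-square : ∀ {d : Fin n} (F R : Word n) → d ∈ F → All (_≡ d) F →
                              ¬ NoRepeat (F ++ F ++ R)
  ¬NoRepeat-constant-square []          R ()
  ¬NoRepeat-constant-square (a ∷ [])    R _ _                 p = proj₁ p refl
  ¬NoRepeat-constant-square (a ∷ b ∷ F) R _ (a≡d ∷ b≡d ∷ _) p = proj₁ p (trans a≡d (≡.sym b≡d))

  ≟-either : (c d : Fin n) → Decidable (λ z → z ≡ c ⊎ z ≡ d)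
  ≟-either c d z = (z ≟ c) ⊎-dec (z ≟ d)

  restrict-++ : ∀ (c d : Fin n) (A B : Word n) →
                restrict c d (A ++ B) ≡ restrict c d A ++ restrict c d B
  restrict-++ c d = filter-++ (≟-either c d)

  restrict-avoiding : ∀ {c d : Fin n} (X : Word n) → c ∉ X → All (_≡ d) (restrict c d X)
  restrict-avoiding {c} {d} X c∉X = tabulate λ a∈ → equals-d (∈-filter⁻ (≟-either c d) {xs = X} a∈)
    where
    equals-d : ∀ {a} → a ∈ X × (a ≡ c ⊎ a ≡ d) → a ≡ d
    equals-d (a∈X , inj₁ refl) = contradiction a∈X c∉X
    equals-d (_   , inj₂ a≡d)  = a≡d

  ∈-restrictʳ : ∀ (c : Fin n) {d : Fin n} {X : Word n} → d ∈ X → d ∈ restrict c d X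
  ∈-restrictʳ c {d} d∈X = ∈-filter⁺ (≟-either c d) d∈X (inj₂ refl)

  ¬Alternate-square : ∀ {c d : Fin n} (u X v : Word n) → c ∉ X → d ∈ X →
                      ¬ Alternate c d (u ++ (X ++ X) ++ v)
  ¬Alternate-square {c} {d} u X v c∉X d∈X alt =
    ¬NoRepeat-constant-square F (restrict c d v) (∈-restrictʳ c d∈X) (restrict-avoiding X c∉X)
      (NoRepeat-++⁻ʳ (restrict c d u) _ (subst NoRepeat restrict-split alt))
    where
    F = restrict c d X
    open ≡.≡-Reasoning
    restrict-split : restrict c d (u ++ (X ++ X) ++ v) ≡ restrict c d u ++ F ++ F ++ restrict c d v
    restrict-split = begin
      restrict c d (u ++ (X ++ X) ++ v)                      ≡⟨ restrict-++ c d u _ ⟩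
      restrict c d u ++ restrict c d ((X ++ X) ++ v)         ≡⟨ cong (restrict c d u ++_) (restrict-++ c d (X ++ X) v) ⟩
      restrict c d u ++ restrict c d (X ++ X) ++ restrict c d v
        ≡⟨ cong (λ Y → restrict c d u ++ Y ++ restrict c d v) (restrict-++ c d X X) ⟩
      restrict c d u ++ (F ++ F) ++ restrict c d v           ≡⟨ cong (restrict c d u ++_) (++-assoc F F _) ⟩
      restrict c d u ++ F ++ F ++ restrict c d v             ∎

  Walk-boundaryEdge : ∀ {ℓ} (G : Graph n) {P : Pred (Fin n) ℓ} → Decidable P →
                      ∀ {a b} → Walk G a b → ¬ P a → P b →
                      ∃₂ λ c d → Adj G c d × ¬ P c × P d
  Walk-boundaryEdge G P? here ¬Pa Pb = contradiction Pb ¬Pa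
  Walk-boundaryEdge G P? {a} (step {y = y} a~y walk) ¬Pa Pb with P? y
  ... | yes Py  = a , y , a~y , ¬Pa , Py
  ... | no  ¬Py = Walk-boundaryEdge G P? walk ¬Py Pb

mainTheorem1 : ∀ (n : ℕ) (G : Graph n) → Connected G →
    WordRepresentable G →
    ∀ (w : Word n) → Represents w G →
    ∀ (u X v : Word n) → w ≡ u ++ (X ++ X) ++ v → length X ≥ 2 →
    ∀ (x : Fin n) → x ∈ X
mainTheorem1 n G connected _ w (_ , represents) u X@(y ∷ _) v refl _ x =
  decidable-stable (x ∈? X) λ x∉X →
    nonAlternatingEdge (Walk-boundaryEdge G (_∈? X) (connected x y) x∉X (here refl))
  where
  open DecMembership (_≟_ {n}) using (_∈?_)

  nonAlternatingEdge : ¬ ∃₂ λ c d → Adj G c d × c ∉ X × d ∈ X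
  nonAlternatingEdge (c , d , c~d , c∉X , d∈X) =
    ¬Alternate-square u X v c∉X d∈X (Equivalence.from (represents c d c≢d) c~d)
    where
    c≢d : ¬ c ≡ d
    c≢d refl = c∉X d∈X
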